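{- The graph $T$ constructed by Algorithm 2 (described in the context), applied to the output $L$ and cores $C_i$ ($i\in L$) of Algorithm 1, is a tree and spans all demand nodes.
   Context: Instance: a connected undirected graph $G=(V,E)$ with nonnegative edge lengths $l_e$, a root $r\in V$, and a set $\mathcal{D}\subseteq V$ of demand nodes with positive integer demands $d_v$; $D=\sum_v d_v$. A routing tree is a tree $T$ in $G$ containing $r$ and all demand nodes; each demand node $v$ sends $d_v$ units of flow along the unique $v$–$r$ path in $T$, giving total flow $x_e$ on each edge $e$ of $T$; $g(T)=\sum_{e\in T}l_e g(x_e)$. Fix $\epsilon>0$, let $K=\lceil \log_{1+\epsilon} D\rceil$, and for $0\le i\le K$ let $M_i=(1+\epsilon)^i$, $A_i(x)=\min\{x,M_i\}$, and $T_i^*$ a routing tree minimizing $A_i(\cdot)$. A $\lambda$-approximation for single-sink rent-or-buy returns, for each $i$, a routing tree $T$ with $A_i(T)\le\lambda A_i(T_i^*)$. For a routing tree $T_i$ with flows $x_e$, its rent cost is $R_i=\sum_{e\in T_i,\,x_e<M_i} l_e x_e$, its normalized buy cost is $B_i=\sum_{e\in T_i,\,x_e\ge M_i} l_e$, and its core $C_i$ consists of $r$ together with all endpoints of edges with $x_e\ge M_i$. Algorithm 1 (parameters $\gamma>1,\delta>1$): (1) for each $i=0,\dots,K$ let $T_i$ be the tree returned by the $\lambda$-approximation for $A_i$; (2) for $i=1,\dots,K$ in increasing order, if $A_i(T_{i-1})<A_i(T_i)$ replace $T_i$ by $T_{i-1}$; (3) for $i=K-1,\dots,0$ in decreasing order,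 if $A_i(T_{i+1})<A_i(T_i)$ replace $T_i$ by $T_{i+1}$; (4) compute $C_i,B_i,R_i$ for the resulting trees $T_i$; (5) set $B=\infty$, $L_B=\emptyset$, and for $i=0,\dots,K$ in increasing order, if $B_i<B/\gamma$ add $i$ to $L_B$ and set $B\leftarrow B_i$; (6) set $R=\infty$, $L=\emptyset$, and for $i\in L_B$ in decreasing order, if $R_i<R/\delta$ add $i$ to $L$ and set $R\leftarrow R_i$. Output $L$ and the cores $C_i$, $i\in L$. For $\alpha,\beta\ge1$, an $(\alpha,\beta)$-LAST of a graph $H$ with root $s$ is a spanning tree of $H$ in which every vertex's tree distance to $s$ is at most $\alpha$ times its shortest-path distance to $s$ in $H$, and whose total edge length is at most $\beta$ times that of a minimum spanning tree of $H$; one exists and can be computed whenever $\alpha>1$ and $\beta\ge(\alpha+1)/(\alpha-1)$. Algorithm 2 (parameters $\alpha>1$, $\beta\ge(\alpha+1)/(\alpha-1)$): start with $T=\{r\}$; for each $i\in L$ in decreasing order, let $T'$ be an $(\alpha,\beta)$-LAST of the graph $(G/T)[C_i]$ (obtained from $G$ by contracting the current $T$ to a single vertex and then taking the subgraph induced on $C_i$ together with the contracted vertex), rooted at the contracted vertex, and set $T\leftarrow T\cup T'$ (edges of $T'$ read as edges of $G$). Output $T$.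
   Formalization: The edge lengths $l_e$ and the parameters ε, λ, γ, δ, α and β take rational values. -}

module Defs where

open import Data.Nat as ℕ using (ℕ; zero; suc; _∸_)
open import Data.Integer using (+_)
open import Data.Rational using (ℚ; 0ℚ; 1ℚ; _+_; _*_; _⊓_; _≤ᵇ_; _/_)
open import Data.Bool using (Bool; true; false; if_then_else_; _∧_; _∨_; not)
open import Data.Fin using (Fin)
open import Data.Fin.Properties using (_≟_)
open import Data.List using (List; []; _∷_; map; foldr; reverse)
open import Data.List.Membership.Propositional using (_∈_)
open import Data.List.Relation.Unary.Unique.Propositional using (Unique)
open import Data.Maybe using (Maybe; just; nothing)
open import Data.Product using (_×_; _,_; Σ; ∃; proj₁; proj₂)
open import Data.Sum using (_⊎_)
open import Data.List using (allFin)
open import Data.Nat.ListAction using () renaming (sum to sumℕ)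
open import Data.Bool.ListAction using (any)
open import Data.Unit using (⊤)
open import Function.Bundles using (_⇔_)
open import Relation.Binary.PropositionalEquality using (_≡_)
open import Relation.Nullary.Decidable using (⌊_⌋)

ℕ→ℚ : ℕ → ℚ
ℕ→ℚ k = (+ k) / 1

_^ℚ_ : ℚ → ℕ → ℚ
p ^ℚ zero    = 1ℚ
p ^ℚ (suc k) = p * (p ^ℚ k)

_<ᵇ_ : ℚ → ℚ → Bool
p <ᵇ q = not (q ≤ᵇ p)

sumℚ : List ℚ → ℚ
sumℚ = foldr _+_ 0ℚ

module Generic {V : Set} {m : ℕ} (ends : Fin m → V × V) (len : Fin m → ℚ) where

  Joins : Fin m → V → V → Set
  Joins e u w = ends e ≡ (u , w) ⊎ ends e ≡ (w , u)

  EndOf : V → Fin m → Set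
  EndOf v e = proj₁ (ends e) ≡ v ⊎ proj₂ (ends e) ≡ v

  data Walk (F : Fin m → Bool) : V → V → List (Fin m) → Set where
    nil  : ∀ {v} → Walk F v v []
    cons : ∀ {u w x e es} → F e ≡ true → Joins e u w →
           Walk F w x es → Walk F u x (e ∷ es)

  lengthW : List (Fin m) → ℚ
  lengthW es = sumℚ (map len es)

  weight : (Fin m → Bool) → ℚ
  weight F = sumℚ (map (λ e → if F e then len e else 0ℚ) (allFin m))

  VS : (Fin m → Bool) → V → V → Set
  VS F s v = v ≡ s ⊎ Σ (Fin m) (λ e → F e ≡ true × EndOf v e)

  IsTree : (Fin m → Bool) → V → Set
  IsTree F s =
    (∀ v → VS F s v → ∃ λ es → Walk F s v es) ×
    (∀ v es → Walk F v v es → Unique es → es ≡ [])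

  IsSpanningTree : (E : Fin m → Bool) → (W : V → Set) → V → (Fin m → Bool) → Set
  IsSpanningTree E W s F =
    (∀ e → F e ≡ true → E e ≡ true) × IsTree F s × (∀ v → VS F s v ⇔ W v)

  -- (α,β)-LAST of the graph (E, W) rooted at s:
  -- tree distances at most α times shortest-path distances in the graph,
  -- total length at most β times that of a minimum spanning tree.
  IsLAST : ℚ → ℚ → (E : Fin m → Bool) → (W : V → Set) → V → (Fin m → Bool) → Set
  IsLAST α β E W s F =
    IsSpanningTree E W s F ×
    (∀ v → W v → ∀ es → Walk E s v es →
       ∃ λ ps → Walk F s v ps × (lengthW ps Data.Rational.≤ α * lengthW es)) ×
    (∀ S → IsSpanningTree E W s S → weight F Data.Rational.≤ β * weight S)

record Instance : Set where
  field
    n    : ℕ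
    m    : ℕ
    ends : Fin m → Fin n × Fin n
    len  : Fin m → ℚ
    r    : Fin n
    d    : Fin n → ℕ

module Inst (I : Instance) where
  open Instance I public
  open Generic ends len public

  allE : Fin m → Bool
  allE _ = true

  Demand : Fin n → Set
  Demand v = 0 ℕ.< d v

  Dtot : ℕ
  Dtot = sumℕ (map d (allFin n))

  -- e lies on the (unique, in a tree) v–r path of F
  OnPath : (Fin m → Bool) → Fin m → Fin n → Set
  OnPath F e v = ∃ λ es → Walk F v r es × Unique es × e ∈ es

  -- x is the flow induced by routing every d_v along the v–r path of F:
  -- x e = Σ_v d_v [e on the v–r path]
  IsFlow : (Fin m → Bool) → (Fin m → ℕ) → Set
  IsFlow F x = ∀ e → Σ (Fin n → Bool) λ χ →
    (∀ v → (χ v ≡ true) ⇔ OnPath F e v) ×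
    (x e ≡ sumℕ (map (λ v → if χ v then d v else 0) (allFin n)))

  record RoutingTree : Set where
    field
      edges    : Fin m → Bool
      flow     : Fin m → ℕ
      isTree   : IsTree edges r
      spans    : ∀ v → Demand v → VS edges r v
      isFlow   : IsFlow edges flow
  open RoutingTree public

  module Params (ε : ℚ) where
    M : ℕ → ℚ
    M i = (1ℚ + ε) ^ℚ i

    A : ℕ → RoutingTree → ℚ
    A i T = sumℚ (map (λ e → if edges T e then len e * (ℕ→ℚ (flow T e) ⊓ M i) else 0ℚ) (allFin m))

    bought : ℕ → RoutingTree → Fin m → Bool
    bought i T e = edges T e ∧ (M i ≤ᵇ ℕ→ℚ (flow T e))

    Rc : ℕ → RoutingTree → ℚ
    Rc i T = sumℚ (map (λ e → if edges T e ∧ not (M i ≤ᵇ ℕ→ℚ (flow T e))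
                               then len e * ℕ→ℚ (flow T e) else 0ℚ) (allFin m))

    Bc : ℕ → RoutingTree → ℚ
    Bc i T = sumℚ (map (λ e → if bought i T e then len e else 0ℚ) (allFin m))

    core : ℕ → RoutingTree → Fin n → Bool
    core i T v = ⌊ v ≟ r ⌋ ∨
      any (λ e → bought i T e ∧ (⌊ proj₁ (ends e) ≟ v ⌋ ∨ ⌊ proj₂ (ends e) ≟ v ⌋)) (allFin m)

    -- K = ⌈log_{1+ε} D⌉ : least K with D ≤ (1+ε)^K
    IsK : ℕ → Set
    IsK K = (ℕ→ℚ Dtot Data.Rational.≤ M K) × (∀ j → j ℕ.< K → M j Data.Rational.< ℕ→ℚ Dtot)

    module Alg1 (K : ℕ) (T₀ : ℕ → RoutingTree) (γ δ : ℚ) where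
      fwd : ℕ → RoutingTree
      fwd zero    = T₀ zero
      fwd (suc i) = if A (suc i) (fwd i) <ᵇ A (suc i) (T₀ (suc i)) then fwd i else T₀ (suc i)

      -- step (3): backward pass; bwd j is the final tree at index K ∸ j
      bwd : ℕ → RoutingTree
      bwd zero    = fwd K
      bwd (suc j) = if A (K ∸ suc j) (bwd j) <ᵇ A (K ∸ suc j) (fwd (K ∸ suc j))
                    then bwd j else fwd (K ∸ suc j)

      T : ℕ → RoutingTree
      T i = bwd (K ∸ i)

      -- x < y/c  with y = ∞ represented by nothing  (c > 0, so x < y/c ⇔ x·c < y)
      below : ℚ → ℚ → Maybe ℚ → Bool
      below x c nothing  = true
      below x c (just y) = (x * c) <ᵇ y

      LB-go : ℕ → ℕ → Maybe ℚ → List ℕ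
      LB-go zero      i B = []
      LB-go (suc cnt) i B =
        if below (Bc i (T i)) γ B
        then i ∷ LB-go cnt (suc i) (just (Bc i (T i)))
        else LB-go cnt (suc i) B

      LB : List ℕ
      LB = LB-go (suc K) 0 nothing

      -- step (6): L, listed in the order of insertion (decreasing)
      L-go : List ℕ → Maybe ℚ → List ℕ
      L-go []       R = []
      L-go (i ∷ is) R =
        if below (Rc i (T i)) δ R
        then i ∷ L-go is (just (Rc i (T i)))
        else L-go is R

      L : List ℕ
      L = L-go (reverse LB) nothing

      C : ℕ → Fin n → Bool
      C i = core i (T i)

  inVS : (Fin m → Bool) → Fin n → Bool
  inVS F v = ⌊ v ≟ r ⌋ ∨
    any (λ e → F e ∧ (⌊ proj₁ (ends e) ≟ v ⌋ ∨ ⌊ proj₂ (ends e) ≟ v ⌋)) (allFin m)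

  -- vertex of G/F: nothing = the contracted vertex (vertices of F)
  cls : (Fin m → Bool) → Fin n → Maybe (Fin n)
  cls F v = if inVS F v then nothing else just v

  endsC : (Fin m → Bool) → Fin m → Maybe (Fin n) × Maybe (Fin n)
  endsC F e = cls F (proj₁ (ends e)) , cls F (proj₂ (ends e))

  -- edges of (G/F)[C]: both endpoints in C ∪ V(F), not both in V(F)
  edgesH : (Fin m → Bool) → (Fin n → Bool) → Fin m → Bool
  edgesH F C e =
    ((C (proj₁ (ends e)) ∨ inVS F (proj₁ (ends e))) ∧
     (C (proj₂ (ends e)) ∨ inVS F (proj₂ (ends e)))) ∧
    not (inVS F (proj₁ (ends e)) ∧ inVS F (proj₂ (ends e)))

  vertsH : (Fin m → Bool) → (Fin n → Bool) → Maybe (Fin n) → Set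
  vertsH F C nothing  = ⊤
  vertsH F C (just v) = C v ≡ true × inVS F v ≡ false

  IsLASTof : ℚ → ℚ → (Fin m → Bool) → (Fin n → Bool) → (Fin m → Bool) → Set
  IsLASTof α β F C T' = Generic.IsLAST (endsC F) len α β (edgesH F C) (vertsH F C) nothing T'

  data Alg2Run (α β : ℚ) (C : ℕ → Fin n → Bool) : (Fin m → Bool) → List ℕ → (Fin m → Bool) → Set where
    done : ∀ {F} → Alg2Run α β C F [] F
    step : ∀ {F T' i is Fn} → IsLASTof α β F (C i) T' →
           Alg2Run α β C (λ e → F e ∨ T' e) is Fn →
           Alg2Run α β C F (i ∷ is) Fn

  noEdges : Fin m → Bool
  noEdges _ = false

module Submission where

-- The proof combines three independent facts.
-- (1) Algorithm 2 preserves trees.  If F is a tree containing r and T' is a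
--     tree of the contracted graph G/F rooted at the contracted vertex, then
--     F ∪ T' is a tree: walks of T' in G/F lift to walks of F ∪ T' from r
--     (connectivity), and a closed walk of F ∪ T' with distinct edges projects
--     to one of T' in G/F, so it uses no T'-edge and is a closed walk of F,
--     hence empty (acyclicity).  Since T' spans C_i, the final tree contains
--     every core C_i with i ∈ L.
-- (2) Every demand node lies in C_0: its path to r in a routing tree starts
--     with an edge of flow at least d_v ≥ 1 = M_0, which is bought at level 0.
-- (3) 0 ∈ L.  Cost accounting gives M_i B_i ≤ A_i ≤ M_i B_{i+1} + R_{i+1},
--     and after the backward pass A_i(T_i) ≤ A_i(T_{i+1}); so B_{i+1} < B_i
--     forces R_{i+1} > 0.  Every index added to L_B after 0 strictly lowers
--     B, hence has positive rent, while R_0 = 0 because integral flows below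
--     M_0 = 1 vanish.  Thus index 0, processed last in step (6), always passes
--     the test R_0 < R/δ.

open import Defs
open import Data.Nat using (ℕ; _≤_)
open import Data.Rational using (ℚ; 0ℚ; 1ℚ; _+_; _-_; _*_; _<_)
open import Data.Fin using (Fin)
open import Data.Product using (_×_; ∃)
open import Data.Bool using (Bool)

open import Algebra.Bundles using (CommutativeMonoid)
open import Data.Bool using (true; false; if_then_else_; _∨_; _∧_; not)
open import Data.Bool.Properties using (∨-zeroʳ; not-injective; T-≡)
open import Data.Bool.ListAction using (any)
open import Data.Fin.Properties using (_≟_)
open import Data.Integer as ℤ using ()
import Data.Integer.Properties as ℤP
open import Data.List using (List; []; _∷_; _++_; allFin; map; filterᵇ; reverseAcc)
open import Data.List.Membership.Propositional using (_∈_)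
open import Data.List.Membership.Propositional.Properties using (∈-allFin)
import Data.List.Membership.DecPropositional as DecMembership
open import Data.List.Relation.Unary.All using (All; []; _∷_)
open import Data.List.Relation.Unary.All.Properties.Core using (¬Any⇒All¬)
open import Data.List.Relation.Unary.AllPairs using ([]; _∷_)
open import Data.List.Relation.Unary.Any using (here; there)
open import Data.List.Relation.Unary.Unique.Propositional using (Unique)
open import Data.List.Relation.Unary.Unique.Propositional.Properties using (filter⁺)
open import Data.Maybe using (Maybe; just; nothing)
open import Data.Nat as ℕ using (zero; suc; _∸_; z≤n; s≤s)
open import Data.Nat.ListAction using () renaming (sum to sumℕ)
import Data.Nat.Coprimality as Coprime
import Data.Nat.Properties as ℕP
open import Data.Product using (_,_; proj₁; proj₂)
import Data.Rational as Q
import Data.Rational.Properties as QP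
open import Data.Sum using (_⊎_; inj₁; inj₂)
open import Data.Unit using (⊤; tt)
open import Function.Base using (_∘_)
open import Function.Bundles using (Equivalence; _⇔_)
open import Relation.Nullary using (Dec; ¬_; contradiction)
open import Relation.Nullary.Decidable using (⌊_⌋; fromWitness; toWitness; yes; no; T?)
open import Relation.Binary.PropositionalEquality

open import Algebra.Properties.CommutativeSemigroup
  (CommutativeMonoid.commutativeSemigroup QP.+-0-commutativeMonoid) using (interchange)

∨-true⁻ : ∀ a b → a ∨ b ≡ true → a ≡ true ⊎ b ≡ true
∨-true⁻ true  b _ = inj₁ refl
∨-true⁻ false b p = inj₂ p

∨-trueˡ : ∀ {a} b → a ≡ true → a ∨ b ≡ true
∨-trueˡ b refl = refl

∨-trueʳ : ∀ a {b} → b ≡ true → a ∨ b ≡ true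
∨-trueʳ a refl = ∨-zeroʳ a

∧-true⁻ : ∀ a b → a ∧ b ≡ true → a ≡ true × b ≡ true
∧-true⁻ true true _ = refl , refl

∧-true⁺ : ∀ {a b} → a ≡ true → b ≡ true → a ∧ b ≡ true
∧-true⁺ refl refl = refl

isYes-true⁺ : ∀ {A : Set} (a? : Dec A) → A → ⌊ a? ⌋ ≡ true
isYes-true⁺ a? a = Equivalence.to T-≡ (fromWitness a)

isYes-true⁻ : ∀ {A : Set} (a? : Dec A) → ⌊ a? ⌋ ≡ true → A
isYes-true⁻ a? eq = toWitness (Equivalence.from T-≡ eq)

any-true⁺ : ∀ {A : Set} (p : A → Bool) {x} xs → x ∈ xs → p x ≡ true →
            any p xs ≡ true
any-true⁺ p (y ∷ ys) (here refl) px = ∨-trueˡ (any p ys) px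
any-true⁺ p (y ∷ ys) (there x∈)  px = ∨-trueʳ (p y) (any-true⁺ p ys x∈ px)

any-true⁻ : ∀ {A : Set} (p : A → Bool) xs → any p xs ≡ true → ∃ λ x → p x ≡ true
any-true⁻ p (y ∷ ys) h with ∨-true⁻ (p y) (any p ys) h
... | inj₁ py = y , py
... | inj₂ pys = any-true⁻ p ys pys

if-intro : ∀ {A : Set} (P : A → Set) (b : Bool) {x y : A} →
           (b ≡ true → P x) → (b ≡ false → P y) → P (if b then x else y)
if-intro P true  t f = t refl
if-intro P false t f = f refl

module WalkFacts {V : Set} {m : ℕ} (ends : Fin m → V × V) (len : Fin m → ℚ) where
  open Generic ends len

  joins-sym : ∀ {e u w} → Joins e u w → Joins e w u
  joins-sym (inj₁ eq) = inj₂ eq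
  joins-sym (inj₂ eq) = inj₁ eq

  joins-end : ∀ {e u w} → Joins e u w → EndOf u e
  joins-end (inj₁ eq) = inj₁ (cong proj₁ eq)
  joins-end (inj₂ eq) = inj₂ (cong proj₂ eq)

  joins-other : ∀ {e a b u w} → Joins e a b → Joins e u w → b ≡ u ⊎ b ≡ w
  joins-other (inj₁ p) (inj₁ q) = inj₂ (trans (cong proj₂ (sym p)) (cong proj₂ q))
  joins-other (inj₁ p) (inj₂ q) = inj₁ (trans (cong proj₂ (sym p)) (cong proj₂ q))
  joins-other (inj₂ p) (inj₁ q) = inj₁ (trans (cong proj₁ (sym p)) (cong proj₁ q))
  joins-other (inj₂ p) (inj₂ q) = inj₂ (trans (cong proj₁ (sym p)) (cong proj₁ q))

  walk-mono : ∀ {F G : Fin m → Bool} → (∀ e → F e ≡ true → G e ≡ true) →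
              ∀ {u v es} → Walk F u v es → Walk G u v es
  walk-mono F⊆G nil            = nil
  walk-mono F⊆G (cons fe j w) = cons (F⊆G _ fe) j (walk-mono F⊆G w)

  walk-snoc : ∀ {F u v w e es} → Walk F u v es → F e ≡ true → Joins e v w →
              Walk F u w (es ++ e ∷ [])
  walk-snoc nil            fe j = cons fe j nil
  walk-snoc (cons fe' j' w) fe j = cons fe' j' (walk-snoc w fe j)

  walk-reverse : ∀ {F u v es} → Walk F u v es → ∃ λ es' → Walk F v u es'
  walk-reverse nil = [] , nil
  walk-reverse (cons fe j w) with walk-reverse w
  ... | es' , w' = _ , walk-snoc w' fe (joins-sym j)

  walk-after : ∀ {F w x e es} → Walk F w x es → e ∈ es → Unique es →
               ∃ λ a → ∃ λ b → ∃ λ post →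
                 Joins e a b × Walk F b x post × Unique (e ∷ post)
  walk-after (cons fe j w) (here refl) u       = _ , _ , _ , j , w , u
  walk-after (cons fe j w) (there e∈)  (_ ∷ u) = walk-after w e∈ u

  module Dec∈ = DecMembership {A = Fin m} _≟_

  walk-distinct : ∀ {F u x es} → Walk F u x es → ∃ λ es' → Walk F u x es' × Unique es'
  walk-distinct nil = [] , nil , []
  walk-distinct {F} (cons {x = x} {e} fe j rest) with walk-distinct rest
  ... | es' , w' , u' with e Dec∈.∈? es'
  ... | no e∉ = e ∷ es' , cons fe j w' , ¬Any⇒All¬ es' e∉ ∷ u'
  ... | yes e∈ with walk-after w' e∈ u'
  ...   | _ , b , post , jab , wb , (e∉post ∷ upost) with joins-other jab j
  ...     | inj₁ b≡u = post , subst (λ t → Walk F t x post) b≡u wb , upost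
  ...     | inj₂ b≡w = e ∷ post , cons fe j (subst (λ t → Walk F t x post) b≡w wb) ,
                       e∉post ∷ upost

  walk-first : ∀ {F u x es} → Walk F u x es → ¬ u ≡ x →
               ∃ λ e → e ∈ es × F e ≡ true × EndOf u e
  walk-first nil           u≢x = contradiction refl u≢x
  walk-first (cons fe j w) _   = _ , here refl , fe , joins-end j

ℕ→ℚ-mono : ∀ {a b} → a ℕ.≤ b → ℕ→ℚ a Q.≤ ℕ→ℚ b
ℕ→ℚ-mono {a} {b} a≤b = subst₂ Q._≤_ (sym (as-mkℚ a)) (sym (as-mkℚ b))
  (Q.*≤* (subst₂ ℤ._≤_ (sym (ℤP.*-identityʳ (ℤ.+ a)))
                       (sym (ℤP.*-identityʳ (ℤ.+ b)))
                       (ℤ.+≤+ a≤b)))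
  where
    as-mkℚ : ∀ k → ℕ→ℚ k ≡ Q.mkℚ (ℤ.+ k) 0 (Coprime.sym (Coprime.1-coprimeTo k))
    as-mkℚ k = QP.normalize-coprime (Coprime.sym (Coprime.1-coprimeTo k))

≤ᵇ-sound : ∀ {p q} → (p Q.≤ᵇ q) ≡ true → p Q.≤ q
≤ᵇ-sound eq = QP.≤ᵇ⇒≤ (Equivalence.from T-≡ eq)

≤ᵇ-complete : ∀ {p q} → p Q.≤ q → (p Q.≤ᵇ q) ≡ true
≤ᵇ-complete p≤q = Equivalence.to T-≡ (QP.≤⇒≤ᵇ p≤q)

<ᵇ-sound : ∀ {p q} → (p <ᵇ q) ≡ true → p < q
<ᵇ-sound eq = QP.≰⇒> λ q≤p →
  contradiction (trans (sym (cong not (≤ᵇ-complete q≤p))) eq) λ ()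

<ᵇ-complete : ∀ {p q} → p < q → (p <ᵇ q) ≡ true
<ᵇ-complete {p} {q} p<q with q Q.≤ᵇ p in q≤ᵇp
... | false = refl
... | true  = contradiction (QP.<-≤-trans p<q (≤ᵇ-sound q≤ᵇp)) (QP.<-irrefl refl)

<ᵇ-false : ∀ {p q} → (p <ᵇ q) ≡ false → q Q.≤ p
<ᵇ-false eq = ≤ᵇ-sound (not-injective {y = true} eq)

keep-better : ∀ {X : Set} (f : X → ℚ) (a b : X) →
              f (if f a <ᵇ f b then a else b) Q.≤ f a
keep-better f a b = if-intro (λ t → f t Q.≤ f a) (f a <ᵇ f b)
  (λ _ → QP.≤-refl) (λ a≮b → <ᵇ-false a≮b)

module _ {A : Set} where
  sumℚ-mono : ∀ (f g : A → ℚ) xs → (∀ x → f x Q.≤ g x) →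
              sumℚ (map f xs) Q.≤ sumℚ (map g xs)
  sumℚ-mono f g []       f≤g = QP.≤-refl
  sumℚ-mono f g (x ∷ xs) f≤g = QP.+-mono-≤ (f≤g x) (sumℚ-mono f g xs f≤g)

  sumℚ-zeros : ∀ (xs : List A) → sumℚ (map (λ _ → 0ℚ) xs) ≡ 0ℚ
  sumℚ-zeros []       = refl
  sumℚ-zeros (x ∷ xs) = trans (cong (0ℚ +_) (sumℚ-zeros xs)) (QP.+-identityʳ 0ℚ)

  sumℚ-nonneg : ∀ (f : A → ℚ) xs → (∀ x → 0ℚ Q.≤ f x) → 0ℚ Q.≤ sumℚ (map f xs)
  sumℚ-nonneg f xs 0≤f =
    subst (Q._≤ sumℚ (map f xs)) (sumℚ-zeros xs) (sumℚ-mono (λ _ → 0ℚ) f xs 0≤f)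

  sumℚ-nonpos : ∀ (f : A → ℚ) xs → (∀ x → f x Q.≤ 0ℚ) → sumℚ (map f xs) Q.≤ 0ℚ
  sumℚ-nonpos f xs f≤0 =
    subst (sumℚ (map f xs) Q.≤_) (sumℚ-zeros xs) (sumℚ-mono f (λ _ → 0ℚ) xs f≤0)

  sumℚ-scale : ∀ (c : ℚ) (f : A → ℚ) xs →
               c * sumℚ (map f xs) ≡ sumℚ (map (λ x → c * f x) xs)
  sumℚ-scale c f []       = QP.*-zeroʳ c
  sumℚ-scale c f (x ∷ xs) =
    trans (QP.*-distribˡ-+ c (f x) _) (cong (c * f x +_) (sumℚ-scale c f xs))

  sumℚ-+ : ∀ (f g : A → ℚ) xs →
           sumℚ (map (λ x → f x + g x) xs) ≡ sumℚ (map f xs) + sumℚ (map g xs)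
  sumℚ-+ f g []       = sym (QP.+-identityʳ 0ℚ)
  sumℚ-+ f g (x ∷ xs) =
    trans (cong ((f x + g x) +_) (sumℚ-+ f g xs)) (interchange (f x) (g x) _ _)

nonneg* : ∀ {a b} → 0ℚ Q.≤ a → 0ℚ Q.≤ b → 0ℚ Q.≤ a * b
nonneg* {a} {b} 0≤a 0≤b = QP.nonNegative⁻¹ (a * b)
  {{QP.nonNeg*nonNeg⇒nonNeg a {{Q.nonNegative 0≤a}} b {{Q.nonNegative 0≤b}}}}

increment-pos : ∀ a r → a < a + r → 0ℚ < r
increment-pos a r a<a+r = QP.≰⇒> λ r≤0 → QP.<-irrefl refl
  (QP.<-≤-trans a<a+r (subst (a + r Q.≤_) (QP.+-identityʳ a) (QP.+-monoʳ-≤ a r≤0)))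

-- (1) Algorithm 2 builds a tree containing every core it processes

module Contraction (I : Instance) where
  open Inst I
  open WalkFacts ends len

  incident : (Fin m → Bool) → Fin n → Fin m → Bool
  incident F v e = F e ∧ (⌊ proj₁ (ends e) ≟ v ⌋ ∨ ⌊ proj₂ (ends e) ≟ v ⌋)

  incident⁺ : ∀ F v e → F e ≡ true → EndOf v e → incident F v e ≡ true
  incident⁺ F v e fe (inj₁ eq) =
    ∧-true⁺ fe (∨-trueˡ _ (isYes-true⁺ (proj₁ (ends e) ≟ v) eq))
  incident⁺ F v e fe (inj₂ eq) =
    ∧-true⁺ fe (∨-trueʳ _ (isYes-true⁺ (proj₂ (ends e) ≟ v) eq))

  incident⁻ : ∀ F v e → incident F v e ≡ true → F e ≡ true × EndOf v e
  incident⁻ F v e h with ∧-true⁻ (F e) _ h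
  ... | fe , at with ∨-true⁻ ⌊ proj₁ (ends e) ≟ v ⌋ _ at
  ...   | inj₁ p = fe , inj₁ (isYes-true⁻ (proj₁ (ends e) ≟ v) p)
  ...   | inj₂ p = fe , inj₂ (isYes-true⁻ (proj₂ (ends e) ≟ v) p)

  inVS-complete : ∀ F v → VS F r v → inVS F v ≡ true
  inVS-complete F v (inj₁ v≡r) = ∨-trueˡ _ (isYes-true⁺ (v ≟ r) v≡r)
  inVS-complete F v (inj₂ (e , fe , at)) =
    ∨-trueʳ ⌊ v ≟ r ⌋
      (any-true⁺ (incident F v) (allFin m) (∈-allFin e) (incident⁺ F v e fe at))

  inVS-sound : ∀ F v → inVS F v ≡ true → VS F r v
  inVS-sound F v h with ∨-true⁻ ⌊ v ≟ r ⌋ (any (incident F v) (allFin m)) h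
  ... | inj₁ p = inj₁ (isYes-true⁻ (v ≟ r) p)
  ... | inj₂ p with any-true⁻ (incident F v) (allFin m) p
  ...   | e , pe = inj₂ (e , incident⁻ F v e pe)

  cls-nothing : ∀ F u → cls F u ≡ nothing → inVS F u ≡ true
  cls-nothing F u eq with inVS F u
  ... | true = refl

  cls-just : ∀ F u {w} → cls F u ≡ just w → u ≡ w
  cls-just F u eq with inVS F u
  cls-just F u refl | false = refl

  cls-inVS : ∀ F u → inVS F u ≡ true → cls F u ≡ nothing
  cls-inVS F u eq rewrite eq = refl

  module Quotient (F : Fin m → Bool) = Generic (endsC F) len

  module Union (F T' : Fin m → Bool) (F-tree : IsTree F r)
               (T'-tree : Quotient.IsTree F T' nothing) where
    open Quotient F using () renaming (Walk to WalkQ; Joins to JoinsQ; EndOf to EndOfQ)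

    U : Fin m → Bool
    U e = F e ∨ T' e

    F⊆U : ∀ e → F e ≡ true → U e ≡ true
    F⊆U e = ∨-trueˡ (T' e)

    T'⊆U : ∀ e → T' e ≡ true → U e ≡ true
    T'⊆U e = ∨-trueʳ (F e)

    VS-F⊆U : ∀ v → VS F r v → VS U r v
    VS-F⊆U v (inj₁ v≡r)           = inj₁ v≡r
    VS-F⊆U v (inj₂ (e , fe , at)) = inj₂ (e , F⊆U e fe , at)

    joins-quotient : ∀ {e a b} → Joins e a b → JoinsQ e (cls F a) (cls F b)
    joins-quotient (inj₁ eq) = inj₁ (cong (λ p → cls F (proj₁ p) , cls F (proj₂ p)) eq)
    joins-quotient (inj₂ eq) = inj₂ (cong (λ p → cls F (proj₁ p) , cls F (proj₂ p)) eq)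

    joins-lift : ∀ {e x y} → JoinsQ e x y →
                 ∃ λ a → ∃ λ b → Joins e a b × cls F a ≡ x × cls F b ≡ y
    joins-lift {e} (inj₁ eq) =
      proj₁ (ends e) , proj₂ (ends e) , inj₁ refl , cong proj₁ eq , cong proj₂ eq
    joins-lift {e} (inj₂ eq) =
      proj₂ (ends e) , proj₁ (ends e) , inj₂ refl , cong proj₂ eq , cong proj₁ eq

    F-edge-contracted : ∀ {e a b} → Joins e a b → F e ≡ true → cls F b ≡ cls F a
    F-edge-contracted {e} {a} {b} j fe =
      trans (cls-inVS F b (inVS-complete F b (inj₂ (e , fe , joins-end (joins-sym j)))))
            (sym (cls-inVS F a (inVS-complete F a (inj₂ (e , fe , joins-end j)))))

    Reachable : Fin n → Set
    Reachable u = ∃ λ es → Walk U r u es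

    reachable-F : ∀ u → VS F r u → Reachable u
    reachable-F u u∈F with proj₁ F-tree u u∈F
    ... | es , w = es , walk-mono F⊆U w

    AllReachable : Maybe (Fin n) → Set
    AllReachable x = ∀ u → cls F u ≡ x → Reachable u

    contracted-reachable : AllReachable nothing
    contracted-reachable u eq = reachable-F u (inVS-sound F u (cls-nothing F u eq))

    reachable-step : ∀ {e x y} → T' e ≡ true → JoinsQ e x y →
                     AllReachable x → AllReachable y
    reachable-step {y = nothing} _ _ _ = contracted-reachable
    reachable-step {e} {y = just z} te j reach-x u u↦z with joins-lift j
    ... | a , b , jab , a↦x , b↦z with reach-x a a↦x
    ...   | es , w = es ++ e ∷ [] ,
                     subst (λ t → Walk U r t (es ++ e ∷ []))
                           (trans (cls-just F b b↦z) (sym (cls-just F u u↦z)))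
                           (walk-snoc w (T'⊆U e te) jab)

    reachable-walk : ∀ {x y es} → WalkQ T' x y es → AllReachable x → AllReachable y
    reachable-walk Quotient.nil           reach = reach
    reachable-walk (Quotient.cons te j w) reach =
      reachable-walk w (reachable-step te j reach)

    endOf-quotient : ∀ {v e} → EndOf v e → EndOfQ (cls F v) e
    endOf-quotient (inj₁ eq) = inj₁ (cong (cls F) eq)
    endOf-quotient (inj₂ eq) = inj₂ (cong (cls F) eq)

    U-connected : ∀ v → VS U r v → Reachable v
    U-connected v (inj₁ refl) = [] , nil
    U-connected v (inj₂ (e , ue , at)) with ∨-true⁻ (F e) (T' e) ue
    ... | inj₁ fe = reachable-F v (inj₂ (e , fe , at))
    ... | inj₂ te with proj₁ T'-tree (cls F v) (inj₂ (e , te , endOf-quotient at))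
    ...   | es , w = reachable-walk w contracted-reachable v refl

    -- acyclicity: project walks of U to G/F, keeping only the T'-edges;
    -- on an edge outside T', membership in U is membership in F
    F-of-U : ∀ e → F e ∨ false ≡ true → F e ≡ true
    F-of-U e ue with ∨-true⁻ (F e) false ue
    ... | inj₁ fe = fe

    project : ∀ {u v es} → Walk U u v es → WalkQ T' (cls F u) (cls F v) (filterᵇ T' es)
    project nil = Quotient.nil
    project (cons {e = e} ue j w) with T' e in te
    ... | true  = Quotient.cons te (joins-quotient j) (project w)
    ... | false = subst (λ t → WalkQ T' t _ _) (F-edge-contracted j (F-of-U e ue)) (project w)

    walk-in-F : ∀ {u v es} → Walk U u v es → filterᵇ T' es ≡ [] → Walk F u v es
    walk-in-F nil _ = nil
    walk-in-F (cons {e = e} ue j w) h with T' e in te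
    walk-in-F (cons {e = e} ue j w) () | true
    ... | false = cons (F-of-U e ue) j (walk-in-F w h)

    U-acyclic : ∀ v es → Walk U v v es → Unique es → es ≡ []
    U-acyclic v es w u =
      proj₂ F-tree v es (walk-in-F w no-T'-edge) u
      where
        no-T'-edge : filterᵇ T' es ≡ []
        no-T'-edge =
          proj₂ T'-tree (cls F v) (filterᵇ T' es) (project w) (filter⁺ (T? ∘ T') u)

    U-tree : IsTree U r
    U-tree = U-connected , U-acyclic

    U-covers : (C : Fin n → Bool) → (∀ x → Quotient.VS F T' nothing x ⇔ vertsH F C x) →
               ∀ v → C v ≡ true → VS U r v
    U-covers C spans v cv with inVS F v in iv
    ... | true = VS-F⊆U v (inVS-sound F v iv)
    ... | false with Equivalence.from (spans (just v)) (cv , iv)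
    ...   | inj₂ (e , te , inj₁ eq) = inj₂ (e , T'⊆U e te , inj₁ (cls-just F _ eq))
    ...   | inj₂ (e , te , inj₂ eq) = inj₂ (e , T'⊆U e te , inj₂ (cls-just F _ eq))

  empty-tree : IsTree noEdges r
  empty-tree = connected , acyclic
    where
      connected : ∀ v → VS noEdges r v → ∃ λ es → Walk noEdges r v es
      connected v (inj₁ refl) = [] , nil
      acyclic : ∀ v es → Walk noEdges v v es → Unique es → es ≡ []
      acyclic v .[] nil _ = refl

  -- one step of Algorithm 2 keeps a tree, keeps its vertices and adds the
  -- core; of the LAST property only the spanning-tree part is needed
  union-step : ∀ {α β F Ci T'} → IsLASTof α β F Ci T' → IsTree F r →
               IsTree (λ e → F e ∨ T' e) r ×
               (∀ v → VS F r v → VS (λ e → F e ∨ T' e) r v) ×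
               (∀ v → Ci v ≡ true → VS (λ e → F e ∨ T' e) r v)
  union-step {F = F} {Ci} {T'} ((_ , T'-tree , spans) , _) F-tree =
    U-tree , VS-F⊆U , U-covers Ci spans
    where open Union F T' F-tree T'-tree

  run-tree : ∀ {α β C F is Fn} → Alg2Run α β C F is Fn → IsTree F r →
             IsTree Fn r × (∀ v → VS F r v → VS Fn r v) ×
             (∀ i → i ∈ is → ∀ v → C i v ≡ true → VS Fn r v)
  run-tree done F-tree = F-tree , (λ v v∈ → v∈) , (λ i ())
  run-tree {α} {β} (step last rest) F-tree with union-step {α} {β} last F-tree
  ... | U-tree , F⊆U , Ci⊆U with run-tree rest U-tree
  ...   | Fn-tree , U⊆Fn , covers =
    Fn-tree , (λ v v∈F → U⊆Fn v (F⊆U v v∈F)) ,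
    λ { _ (here refl) v cv → U⊆Fn v (Ci⊆U v cv)
      ; i (there i∈) v cv → covers i i∈ v cv }

-- (2) Demand nodes lie in the core C_0 of every routing tree

term≤sumℕ : ∀ {A : Set} (f : A → ℕ) {x} xs → x ∈ xs → f x ℕ.≤ sumℕ (map f xs)
term≤sumℕ f (y ∷ ys) (here refl) = ℕP.m≤m+n (f y) _
term≤sumℕ f (y ∷ ys) (there x∈)  = ℕP.≤-trans (term≤sumℕ f ys x∈) (ℕP.m≤n+m _ (f y))

module Demands (I : Instance) (ε : ℚ) where
  open Inst I
  open Params ε
  open WalkFacts ends len
  open Contraction I using (inVS-complete)

  demand≤flow : ∀ (Tr : RoutingTree) {e v} → OnPath (edges Tr) e v → d v ℕ.≤ flow Tr e
  demand≤flow Tr {e} {v} on-path with isFlow Tr e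
  ... | χ , χ⇔path , flow≡ = begin
    d v                           ≡⟨ cong (λ b → if b then d v else 0) χv ⟨
    routed v                      ≤⟨ term≤sumℕ routed (allFin n) (∈-allFin v) ⟩
    sumℕ (map routed (allFin n))  ≡⟨ flow≡ ⟨
    flow Tr e                     ∎
    where
      open ℕP.≤-Reasoning
      routed : Fin n → ℕ
      routed u = if χ u then d u else 0
      χv : χ v ≡ true
      χv = Equivalence.from (χ⇔path v) on-path

  path-to-root : ∀ (Tr : RoutingTree) v → Demand v →
                 ∃ λ es → Walk (edges Tr) v r es × Unique es
  path-to-root Tr v dv =
    walk-distinct (proj₂ (walk-reverse (proj₂ (proj₁ (isTree Tr) v (spans Tr v dv)))))

  -- the first edge of the v–r path carries flow ≥ d_v ≥ 1 = M_0
  demand-bought₀ : ∀ (Tr : RoutingTree) v → Demand v → VS (bought 0 Tr) r v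
  demand-bought₀ Tr v dv with v ≟ r
  ... | yes v≡r = inj₁ v≡r
  ... | no  v≢r with path-to-root Tr v dv
  ...   | es , path , distinct with walk-first path v≢r
  ...     | e , e∈ , te , at = inj₂ (e , ∧-true⁺ te (≤ᵇ-complete 1≤flow) , at)
    where
      1≤flow : 1ℚ Q.≤ ℕ→ℚ (flow Tr e)
      1≤flow = ℕ→ℚ-mono (ℕP.≤-trans dv (demand≤flow Tr (es , path , distinct , e∈)))

  -- core 0 Tr is by definition the membership test inVS (bought 0 Tr)
  demand-in-core₀ : ∀ (Tr : RoutingTree) v → Demand v → core 0 Tr v ≡ true
  demand-in-core₀ Tr v dv = inVS-complete (bought 0 Tr) v (demand-bought₀ Tr v dv)

-- Cost accounting: buy cost, rent cost and A_i

-- Per-edge versions of the cost inequalities, for an edge of length l and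
-- flow x that lies in the tree iff inT and reaches the threshold μ iff big.

-- a bought edge contributes μ l to the buy term and l·min(x, μ) = μ l to A
edge-buy≤A : ∀ (inT big : Bool) (l x μ : ℚ) → (big ≡ true → μ Q.≤ x) →
             0ℚ Q.≤ l → 0ℚ Q.≤ x → 0ℚ Q.≤ μ →
             μ * (if inT ∧ big then l else 0ℚ) Q.≤ (if inT then l * (x Q.⊓ μ) else 0ℚ)
edge-buy≤A false big   l x μ _   _   _   _   = QP.≤-reflexive (QP.*-zeroʳ μ)
edge-buy≤A true  true  l x μ μ≤x _   _   _   =
  QP.≤-reflexive (trans (QP.*-comm μ l) (cong (l *_) (sym (QP.p≥q⇒p⊓q≡q (μ≤x refl)))))
edge-buy≤A true  false l x μ _   0≤l 0≤x 0≤μ =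
  subst (Q._≤ l * (x Q.⊓ μ)) (sym (QP.*-zeroʳ μ)) (nonneg* 0≤l (QP.⊓-glb 0≤x 0≤μ))

edge-A≤buy+rent : ∀ (inT big : Bool) (l x μ : ℚ) → 0ℚ Q.≤ l →
                  (if inT then l * (x Q.⊓ μ) else 0ℚ) Q.≤
                  μ * (if inT ∧ big then l else 0ℚ) + (if inT ∧ not big then l * x else 0ℚ)
edge-A≤buy+rent false big   l x μ _ =
  QP.≤-reflexive (sym (trans (cong (_+ 0ℚ) (QP.*-zeroʳ μ)) (QP.+-identityʳ 0ℚ)))
edge-A≤buy+rent true  true  l x μ 0≤l =
  subst (l * (x Q.⊓ μ) Q.≤_) (trans (QP.*-comm l μ) (sym (QP.+-identityʳ (μ * l))))
        (QP.*-monoˡ-≤-nonNeg l {{Q.nonNegative 0≤l}} (QP.p⊓q≤q x μ))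
edge-A≤buy+rent true  false l x μ 0≤l =
  subst (l * (x Q.⊓ μ) Q.≤_)
        (sym (trans (cong (_+ (l * x)) (QP.*-zeroʳ μ)) (QP.+-identityˡ (l * x))))
        (QP.*-monoˡ-≤-nonNeg l {{Q.nonNegative 0≤l}} (QP.p⊓q≤p x μ))

edge-rent≤0 : ∀ (inT big : Bool) (l x : ℚ) → (big ≡ false → x ≡ 0ℚ) →
              (if inT ∧ not big then l * x else 0ℚ) Q.≤ 0ℚ
edge-rent≤0 false big   l x _   = QP.≤-refl
edge-rent≤0 true  true  l x _   = QP.≤-refl
edge-rent≤0 true  false l x x≡0 =
  QP.≤-reflexive (trans (cong (l *_) (x≡0 refl)) (QP.*-zeroʳ l))

module Costs (I : Instance) (ε : ℚ) (ε>0 : 0ℚ < ε)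
             (len≥0 : ∀ e → 0ℚ Q.≤ Instance.len I e) where
  open Inst I
  open Params ε

  M-pos : ∀ i → 0ℚ < M i
  M-pos zero    = QP.positive⁻¹ 1ℚ
  M-pos (suc i) = QP.positive⁻¹ (M (suc i))
    {{QP.pos*pos⇒pos (1ℚ + ε) {{Q.positive 0<1+ε}} (M i) {{Q.positive (M-pos i)}}}}
    where
      0<1+ε : 0ℚ < 1ℚ + ε
      0<1+ε = subst (_< 1ℚ + ε) (QP.+-identityʳ 0ℚ) (QP.+-mono-< (QP.positive⁻¹ 1ℚ) ε>0)

  flow≥0 : ∀ Tr e → 0ℚ Q.≤ ℕ→ℚ (flow Tr e)
  flow≥0 Tr e = ℕ→ℚ-mono {0} {flow Tr e} z≤n

  buy≤A : ∀ i Tr → M i * Bc i Tr Q.≤ A i Tr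
  buy≤A i Tr = subst (Q._≤ A i Tr) (sym (sumℚ-scale (M i) _ (allFin m)))
    (sumℚ-mono _ _ (allFin m) λ e →
       edge-buy≤A (edges Tr e) (M i Q.≤ᵇ ℕ→ℚ (flow Tr e)) (len e) (ℕ→ℚ (flow Tr e)) (M i)
                  ≤ᵇ-sound (len≥0 e) (flow≥0 Tr e) (QP.<⇒≤ (M-pos i)))

  A≤buy+rent : ∀ i j Tr → A i Tr Q.≤ M i * Bc j Tr + Rc j Tr
  A≤buy+rent i j Tr = subst (A i Tr Q.≤_) split-sum
    (sumℚ-mono _ (λ e → buy e + rent e) (allFin m) λ e →
       edge-A≤buy+rent (edges Tr e) (M j Q.≤ᵇ ℕ→ℚ (flow Tr e)) (len e) (ℕ→ℚ (flow Tr e))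
                       (M i) (len≥0 e))
    where
      buy rent : Fin m → ℚ
      buy e  = M i * (if bought j Tr e then len e else 0ℚ)
      rent e = if edges Tr e ∧ not (M j Q.≤ᵇ ℕ→ℚ (flow Tr e))
               then len e * ℕ→ℚ (flow Tr e) else 0ℚ
      split-sum : sumℚ (map (λ e → buy e + rent e) (allFin m)) ≡ M i * Bc j Tr + Rc j Tr
      split-sum = trans (sumℚ-+ buy rent (allFin m))
                        (cong (_+ Rc j Tr) (sym (sumℚ-scale (M i) _ (allFin m))))

  Bc≥0 : ∀ j Tr → 0ℚ Q.≤ Bc j Tr
  Bc≥0 j Tr = sumℚ-nonneg _ (allFin m) λ e → edge-buy≥0 (bought j Tr e) (len≥0 e)
    where
      edge-buy≥0 : ∀ b {l} → 0ℚ Q.≤ l → 0ℚ Q.≤ (if b then l else 0ℚ)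
      edge-buy≥0 true  0≤l = 0≤l
      edge-buy≥0 false _   = QP.≤-refl

  -- integral flows below M_0 = 1 are zero, so nothing is rented at level 0
  Rc₀≤0 : ∀ Tr → Rc 0 Tr Q.≤ 0ℚ
  Rc₀≤0 Tr = sumℚ-nonpos _ (allFin m) λ e →
    edge-rent≤0 (edges Tr e) (1ℚ Q.≤ᵇ ℕ→ℚ (flow Tr e)) (len e) (ℕ→ℚ (flow Tr e))
                (λ small → cong ℕ→ℚ (below-1 (flow Tr e) small))
    where
      below-1 : ∀ k → (1ℚ Q.≤ᵇ ℕ→ℚ k) ≡ false → k ≡ 0
      below-1 zero    _     = refl
      below-1 (suc k) small =
        contradiction (trans (sym small) (≤ᵇ-complete (ℕ→ℚ-mono (s≤s (z≤n {k}))))) λ ()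

-- (3) Algorithm 1 always selects index 0

module FirstIndex (I : Instance) (ε : ℚ) (ε>0 : 0ℚ < ε)
                  (len≥0 : ∀ e → 0ℚ Q.≤ Instance.len I e)
                  (K : ℕ) (T₀ : ℕ → Inst.RoutingTree I) (γ δ : ℚ)
                  (γ>1 : 1ℚ < γ) (δ>1 : 1ℚ < δ) where
  open Inst I
  open Params ε
  open Alg1 K T₀ γ δ
  open Costs I ε ε>0 len≥0

  B R : ℕ → ℚ
  B i = Bc i (T i)
  R i = Rc i (T i)

  γ≥0 : 0ℚ Q.≤ γ
  γ≥0 = QP.<⇒≤ (QP.<-trans (QP.positive⁻¹ 1ℚ) γ>1)

  δ≥0 : 0ℚ Q.≤ δ
  δ≥0 = QP.<⇒≤ (QP.<-trans (QP.positive⁻¹ 1ℚ) δ>1)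

  A-backward : ∀ i → i ℕ.< K → A i (T i) Q.≤ A i (T (suc i))
  A-backward i i<K = subst₂ (λ j t → A j t Q.≤ A j (T (suc i))) index tree
    (keep-better (A (K ∸ suc k)) (bwd k) (fwd (K ∸ suc k)))
    where
      k : ℕ
      k = K ∸ suc i
      K∸i : suc k ≡ K ∸ i
      K∸i = sym (ℕP.+-∸-assoc 1 i<K)
      index : K ∸ suc k ≡ i
      index = trans (cong (K ∸_) K∸i) (ℕP.m∸[m∸n]≡n (ℕP.<⇒≤ i<K))
      tree : bwd (suc k) ≡ T i
      tree = cong bwd K∸i

  -- if the buy cost drops from level i to level i+1, T_{i+1} rents something:
  -- M_i B_{i+1} < M_i B_i ≤ A_i(T_i) ≤ A_i(T_{i+1}) ≤ M_i B_{i+1} + R_{i+1}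
  rent-pos : ∀ i → i ℕ.< K → B (suc i) < B i → 0ℚ < R (suc i)
  rent-pos i i<K drop = increment-pos (M i * B (suc i)) (R (suc i)) (begin-strict
    M i * B (suc i)              <⟨ QP.*-monoʳ-<-pos (M i) {{Q.positive (M-pos i)}} drop ⟩
    M i * B i                    ≤⟨ buy≤A i (T i) ⟩
    A i (T i)                    ≤⟨ A-backward i i<K ⟩
    A i (T (suc i))              ≤⟨ A≤buy+rent i (suc i) (T (suc i)) ⟩
    M i * B (suc i) + R (suc i)  ∎)
    where open QP.≤-Reasoning

  B≤Bγ : ∀ j → B j Q.≤ B j * γ
  B≤Bγ j = subst (Q._≤ B j * γ) (QP.*-identityʳ (B j))
    (QP.*-monoˡ-≤-nonNeg (B j) {{Q.nonNegative (Bc≥0 j (T j))}} (QP.<⇒≤ γ>1))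

  -- Step (5) after index i, with current record b ≤ B_i γ: every index it
  -- adds lowers the buy cost, hence has positive rent.
  LB-rents-pos : ∀ cnt i b → i ℕ.+ cnt ℕ.≤ K → b Q.≤ B i * γ →
                 All (λ j → 0ℚ < R j) (LB-go cnt (suc i) (just b))
  LB-rents-pos zero    i b _     _      = []
  LB-rents-pos (suc c) i b bound b≤Biγ =
    if-intro (All (λ j → 0ℚ < R j)) (below (B (suc i)) γ (just b))
      (λ added → rent-pos i i<K (drop (<ᵇ-sound added)) ∷
                 LB-rents-pos c (suc i) (B (suc i)) bound′ (B≤Bγ (suc i)))
      (λ skipped → LB-rents-pos c (suc i) b bound′ (<ᵇ-false skipped))
    where
      i<K : i ℕ.< K
      i<K = ℕP.<-≤-trans (ℕP.m<m+n i (s≤s z≤n)) bound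
      bound′ : suc i ℕ.+ c ℕ.≤ K
      bound′ = subst (ℕ._≤ K) (ℕP.+-suc i c) bound
      drop : B (suc i) * γ < b → B (suc i) < B i
      drop lt = QP.*-cancelʳ-<-nonNeg γ {{Q.nonNegative γ≥0}} (QP.<-≤-trans lt b≤Biγ)

  -- the record of step (6): ∞, or a positive rent
  PositiveRecord : Maybe ℚ → Set
  PositiveRecord nothing  = ⊤
  PositiveRecord (just y) = 0ℚ < y

  ZeroAdded : List ℕ → Set
  ZeroAdded ys = ∀ rec → PositiveRecord rec → 0 ∈ L-go ys rec

  -- R_0 δ ≤ 0 < y, so index 0 beats every positive record
  zero-passes : ∀ y → 0ℚ < y → below (R 0) δ (just y) ≡ true
  zero-passes y 0<y = <ᵇ-complete (QP.≤-<-trans R₀δ≤0 0<y)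
    where
      R₀δ≤0 : R 0 * δ Q.≤ 0ℚ
      R₀δ≤0 = subst (R 0 * δ Q.≤_) (QP.*-zeroˡ δ)
                (QP.*-monoʳ-≤-nonNeg δ {{Q.nonNegative δ≥0}} (Rc₀≤0 (T 0)))

  zero-added-last : ZeroAdded (0 ∷ [])
  zero-added-last nothing  _   = here refl
  zero-added-last (just y) 0<y = if-intro (0 ∈_) (below (R 0) δ (just y))
    (λ _ → here refl)
    (λ rejected → contradiction (trans (sym rejected) (zero-passes y 0<y)) λ ())

  -- indices with positive rent before 0 leave a positive record behind them
  zero-added-∷ : ∀ x ys → 0ℚ < R x → ZeroAdded ys → ZeroAdded (x ∷ ys)
  zero-added-∷ x ys 0<Rx added rec pos = if-intro (0 ∈_) (below (R x) δ rec)
    (λ _ → there (added (just (R x)) 0<Rx)) (λ _ → added rec pos)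

  zero-added-reverseAcc : ∀ xs ys → All (λ j → 0ℚ < R j) xs → ZeroAdded ys →
                          ZeroAdded (reverseAcc ys xs)
  zero-added-reverseAcc []       ys []          added = added
  zero-added-reverseAcc (x ∷ xs) ys (0<Rx ∷ ps) added =
    zero-added-reverseAcc xs (x ∷ ys) ps (zero-added-∷ x ys 0<Rx added)

  -- L_B = 0 ∷ (indices with positive rent), and L processes it reversed
  zero∈L : 0 ∈ L
  zero∈L = zero-added-reverseAcc (LB-go K 1 (just (B 0))) (0 ∷ [])
             (LB-rents-pos K 0 (B 0) ℕP.≤-refl (B≤Bγ 0)) zero-added-last nothing tt

lemma7 : (I : Instance) → let open Inst I in
    (∀ e → 0ℚ Data.Rational.≤ len e) →
    (∀ v → ∃ λ es → Walk allE r v es) →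
    (ε λ' γ δ α β : ℚ) → 0ℚ < ε → 1ℚ Data.Rational.≤ λ' → 1ℚ < γ → 1ℚ < δ → 1ℚ < α →
    α + 1ℚ Data.Rational.≤ β * (α - 1ℚ) →
    let open Params ε in
    (K : ℕ) → IsK K →
    (T₀ : ℕ → RoutingTree) →
    (∀ i → i ≤ K → ∀ (T* : RoutingTree) → A i (T₀ i) Data.Rational.≤ λ' * A i T*) →
    let open Alg1 K T₀ γ δ in
    ∀ (Tfin : Fin m → Bool) → Alg2Run α β C noEdges L Tfin →
    IsTree Tfin r × (∀ v → Demand v → VS Tfin r v)
lemma7 I len≥0 _ ε _ γ δ _ _ ε>0 _ γ>1 δ>1 _ _ K _ T₀ _ Tfin run
  with Contraction.run-tree I run (Contraction.empty-tree I)
... | Tfin-tree , _ , covers-cores =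
  Tfin-tree , λ v dv → covers-cores 0 zero∈L v (demand-in-core₀ (T 0) v dv)
  where
    open Inst.Params.Alg1 I ε K T₀ γ δ using (T)
    open Demands I ε using (demand-in-core₀)
    open FirstIndex I ε ε>0 len≥0 K T₀ γ δ γ>1 δ>1 using (zero∈L)
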